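{- $\mathrm{Flat}(N)$ is $1$-$\infty$-safe iff $N$ is 1-safe.
   Context: Places $\mathbb{S} = P \cup \mathbf{P}$ are partitioned into regular places $P$ and persistent places $\mathbf{P}$. $N=(T,b)$ is a dynamic p-net over $\mathbb{S}$: elements of the least set $\mathcal{DN}(\mathbb{S}) = \{(T,b) \mid T \subseteq 2^{\mathbb{S}} \times \mathcal{DN}(\mathbb{S}),\ T \text{ finite},\ b \in (\mathbb{N}\cup\{\infty\})^{\mathbb{S}}\}$, where $(S,N')\in T$ is a transition with preset $S$ and postset $N'$; firing $t=S\to(T',b')$ with $S\subseteq b$ gives $(T,b)\xrightarrow{t}(T\cup T',(b\setminus S)\cup b')$. $\mathrm{Flat}(N)$ is the p-net whose transitions are all (nested) transitions $\mathrm{DT}(N)$ of $N$, whose places are $\mathbb{S}$ plus a fresh persistent place $\mathbf{p}_t$ per transition $t$, where each $t=S\to(T',b')$ has preset $S\cup\{\mathbf{p}_t\}$ and postset $b'$ plus $\infty$ tokens in $\mathbf{p}_{t'}$ for $t'\in T'$, and whose initial marking is $b$ plus $\infty$ tokens in $\mathbf{p}_t$ for each top transition $t\in T$. A marked p-net is $1$-$\infty$-safe if every reachable bag $b$ has $b(p)\in\{0,1\}$ for all regular $p$ and $b(\mathbf{p})\in\{0,\infty\}$ for all persistent $\mathbf{p}$; for a dynamic p-net this notion is defined analogously on the bags $b$ of its reachable states $(T,b)$. The result follows from the step-by-step correspondence: $N\xrightarrow{t}N'$ implies $\mathrm{Flat}(N)\xrightarrow{t}\mathrm{Flat}(N')$,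 and conversely every firing $\mathrm{Flat}(N)\xrightarrow{t}N'$ has $N'=\mathrm{Flat}(N'')$ with $N\xrightarrow{t}N''$. -}

module Defs where

open import Data.Nat using (ℕ; zero; suc; _+_; _∸_)
open import Data.Bool using (Bool; true; false; if_then_else_)
open import Data.List using (List; _++_)
open import Data.List.Membership.Propositional using (_∈_)
open import Data.Sum using (_⊎_; inj₁; inj₂)
open import Data.Product using (Σ; ∃; _×_; _,_)
open import Data.Unit using (⊤)
open import Relation.Nullary using (¬_)
open import Relation.Binary.PropositionalEquality using (_≡_; _≢_)
open import Relation.Binary.Construct.Closure.ReflexiveTransitive using (Star)

data ℕ∞ : Set where
  fin : ℕ → ℕ∞
  ∞   : ℕ∞

infixl 6 _+∞_
_+∞_ : ℕ∞ → ℕ∞ → ℕ∞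
fin m +∞ fin n = fin (m + n)
fin _ +∞ ∞     = ∞
∞     +∞ _     = ∞

pred∞ : ℕ∞ → ℕ∞
pred∞ (fin n) = fin (n ∸ 1)
pred∞ ∞       = ∞

Marked : ℕ∞ → Set
Marked k = k ≢ fin 0

-- admissible token counts for 1-∞-safety:
--   regular places (persistence flag false): 0 or 1
--   persistent places (persistence flag true): 0 or ∞
SafeVal : Bool → ℕ∞ → Set
SafeVal false k = k ≡ fin 0 ⊎ k ≡ fin 1
SafeVal true  k = k ≡ fin 0 ⊎ k ≡ ∞

-- Dynamic p-nets over a set of places 𝕊.
-- A preset S ⊆ 𝕊 is given by its characteristic function 𝕊 → Bool;
-- a bag is a function 𝕊 → ℕ∞; the (finite) set T of transitions is a list.

mutual
  data DNet (𝕊 : Set) : Set where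
    dnet : List (DTrans 𝕊) → (𝕊 → ℕ∞) → DNet 𝕊

  data DTrans (𝕊 : Set) : Set where
    _⇒_ : (𝕊 → Bool) → DNet 𝕊 → DTrans 𝕊

module _ {𝕊 : Set} where

  bag : DNet 𝕊 → 𝕊 → ℕ∞
  bag (dnet _ b) = b

  trans : DNet 𝕊 → List (DTrans 𝕊)
  trans (dnet T _) = T

  preset : DTrans 𝕊 → 𝕊 → Bool
  preset (S ⇒ _) = S

  postnet : DTrans 𝕊 → DNet 𝕊
  postnet (_ ⇒ N') = N'

  fireBag : (𝕊 → ℕ∞) → (𝕊 → Bool) → (𝕊 → ℕ∞) → 𝕊 → ℕ∞
  fireBag b S b' s = (if S s then pred∞ (b s) else b s) +∞ b' s

  data Step : DNet 𝕊 → DTrans 𝕊 → DNet 𝕊 → Set where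
    fire : ∀ {T b S T' b'} →
           (S ⇒ dnet T' b') ∈ T →
           (∀ s → S s ≡ true → Marked (b s)) →
           Step (dnet T b) (S ⇒ dnet T' b') (dnet (T ++ T') (fireBag b S b'))

  _⟶_ : DNet 𝕊 → DNet 𝕊 → Set
  N ⟶ N' = ∃ λ t → Step N t N'

  _⟶*_ : DNet 𝕊 → DNet 𝕊 → Set
  _⟶*_ = Star _⟶_

  data _∈DT_ : DTrans 𝕊 → DNet 𝕊 → Set where
    top    : ∀ {t T b} → t ∈ T → t ∈DT dnet T b
    nested : ∀ {t u T b} → u ∈ T → t ∈DT postnet u → t ∈DT dnet T b

  OneSafeD : (𝕊 → Bool) → DNet 𝕊 → Set
  OneSafeD pers N = ∀ N' → N ⟶* N' → ∀ s → SafeVal (pers s) (bag N' s)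

-- Marked p-nets over a set of places Q.
-- Bags are represented relationally: m q k  reads "place q holds exactly k
-- tokens"; presets are predicates on places.

Mark : Set → Set₁
Mark Q = Q → ℕ∞ → Set

record PNet (Q : Set) : Set₁ where
  field
    persistent : Q → Bool
    Tr         : Set
    pre        : Tr → Q → Set
    post       : Tr → Mark Q
    initial    : Mark Q

module _ {Q : Set} (P : PNet Q) where
  open PNet P

  Enabled : Mark Q → Tr → Set
  Enabled m t = ∀ q → pre t q → Σ ℕ∞ λ k → m q k × Marked k

  after : Mark Q → Tr → Mark Q
  after m t q k' = Σ ℕ∞ λ k → Σ ℕ∞ λ j → m q k × post t q j ×
                   ((pre t q × k' ≡ pred∞ k +∞ j) ⊎ (¬ pre t q × k' ≡ k +∞ j))

  data Reachable : Mark Q → Set₁ where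
    init : Reachable initial
    step : ∀ {m} → Reachable m → (t : Tr) → Enabled m t → Reachable (after m t)

  OneInfSafe : Set₁
  OneInfSafe = ∀ m → Reachable m → ∀ q k → m q k → SafeVal (persistent q) k

-- Flat(N): places 𝕊 plus a fresh persistent place p_t (= inj₂ t) per transition t.

module _ {𝕊 : Set} where

  freshBag : List (DTrans 𝕊) → DTrans 𝕊 → ℕ∞ → Set
  freshBag T u k = (u ∈ T × k ≡ ∞) ⊎ (¬ (u ∈ T) × k ≡ fin 0)

  Flat : (𝕊 → Bool) → DNet 𝕊 → PNet (𝕊 ⊎ DTrans 𝕊)
  Flat pers N = record
    { persistent = λ { (inj₁ s) → pers s ; (inj₂ _) → true }
    ; Tr         = Σ (DTrans 𝕊) (λ t → t ∈DT N)
    ; pre        = λ { (t , _) (inj₁ s) → preset t s ≡ true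
                     ; (t , _) (inj₂ u) → u ≡ t }
    ; post       = λ { (t , _) (inj₁ s) k → k ≡ bag (postnet t) s
                     ; (t , _) (inj₂ u) k → freshBag (trans (postnet t)) u k }
    ; initial    = λ { (inj₁ s) k → k ≡ bag N s
                     ; (inj₂ u) k → freshBag (trans N) u k }
    }

module Submission where

-- The proof rests on the step-by-step correspondence between N and Flat(N).
-- To a dynamic state N' we associate the "flat marking" of Flat(N'): the
-- bag of N' on the regular places, and on each persistent place p_u either
-- ∞ tokens (u is a current transition of N') or none ('freshBag').  Markings
-- of Flat(N) are relations, so we compare a marking m with the flat marking
-- of N' in both directions:
--   * Sound m N'    — every value of m is the flat value;
--   * Complete m N' — every flat value is a value of m; on persistent places
--     only up to double negation, since membership u ∈ T is undecidable.
-- Firing a Flat transition from a marking sound for N' is a step of N' and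
-- yields a marking sound for the successor state ('represent'); conversely a
-- step of N' is matched, ¬¬-constructively, by a Flat transition preserving
-- completeness ('simulate').  As safety of a single place is decidable, hence
-- stable under ¬¬, both implications of the corollary follow.

open import Defs
open import Data.Bool using (Bool; true; false)
open import Data.Nat using (suc)
open import Data.List using (_++_)
open import Data.List.Membership.Propositional using (_∈_)
open import Data.List.Membership.Propositional.Properties using (∈-++⁺ˡ; ∈-++⁺ʳ; ∈-++⁻)
open import Data.Sum using (_⊎_; inj₁; inj₂; [_,_])
open import Data.Product using (Σ; ∃; _×_; _,_)
open import Function.Bundles using (_⇔_; mk⇔)
open import Level using (Level)
open import Relation.Nullary using (¬_; Dec; yes; no)
open import Relation.Nullary.Decidable using (decidable-stable; ¬¬-excluded-middle)
open import Relation.Nullary.Negation using (contradiction; negated-stable; ¬¬-map)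
open import Relation.Binary.PropositionalEquality using (_≡_; refl; sym; subst; cong)
open import Relation.Binary.Construct.Closure.ReflexiveTransitive using (ε; _◅_; _◅◅_)

private
  variable
    a b : Level
    A : Set a
    B : Set b

-- The double-negation monad, with a bind that may change universe level
-- (reachable markings live in Set₁).
return : A → ¬ ¬ A
return = contradiction

_>>=_ : ¬ ¬ A → (A → ¬ ¬ B) → ¬ ¬ B
h >>= f = negated-stable (¬¬-map f h)

-- Safety of a place is decidable, so it can be concluded from its double negation.
safeVal? : ∀ p k → Dec (SafeVal p k)
safeVal? false (fin 0)             = yes (inj₁ refl)
safeVal? false (fin 1)             = yes (inj₂ refl)
safeVal? false (fin (suc (suc n))) = no λ { (inj₁ ()) ; (inj₂ ()) }
safeVal? false ∞                   = no λ { (inj₁ ()) ; (inj₂ ()) }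
safeVal? true  (fin 0)             = yes (inj₁ refl)
safeVal? true  (fin (suc n))       = no λ { (inj₁ ()) ; (inj₂ ()) }
safeVal? true  ∞                   = yes (inj₂ refl)

safeVal-stable : ∀ p k → ¬ ¬ SafeVal p k → SafeVal p k
safeVal-stable p k = decidable-stable (safeVal? p k)

module _ {𝕊 : Set} where

  fresh-total : ∀ T (u : DTrans 𝕊) → ¬ ¬ ∃ (freshBag T u)
  fresh-total T u = do
    yes u∈T ← ¬¬-excluded-middle
      where no u∉T → return (fin 0 , inj₂ (u∉T , refl))
    return (∞ , inj₁ (u∈T , refl))

  fresh-unique : ∀ {T} {u : DTrans 𝕊} {k k'} → freshBag T u k → freshBag T u k' → k ≡ k'
  fresh-unique (inj₁ (_   , refl)) (inj₁ (_   , refl)) = refl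
  fresh-unique (inj₁ (u∈T , _))    (inj₂ (u∉T , _))    = contradiction u∈T u∉T
  fresh-unique (inj₂ (u∉T , _))    (inj₁ (u∈T , _))    = contradiction u∈T u∉T
  fresh-unique (inj₂ (_   , refl)) (inj₂ (_   , refl)) = refl

  fresh-safe : ∀ {T} {u : DTrans 𝕊} {k} → freshBag T u k → SafeVal true k
  fresh-safe (inj₁ (_ , k≡∞)) = inj₂ k≡∞
  fresh-safe (inj₂ (_ , k≡0)) = inj₁ k≡0

  fresh-pred : ∀ {T} {u : DTrans 𝕊} {k} → freshBag T u k → pred∞ k ≡ k
  fresh-pred (inj₁ (_ , refl)) = refl
  fresh-pred (inj₂ (_ , refl)) = refl

  fresh-marked : ∀ {T} {u : DTrans 𝕊} {k} → freshBag T u k → Marked k → u ∈ T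
  fresh-marked (inj₁ (u∈T , _))   _    = u∈T
  fresh-marked (inj₂ (_ , k≡0)) marked = contradiction k≡0 marked

  fresh-++ : ∀ {T T'} {u : DTrans 𝕊} {k j} →
             freshBag T u k → freshBag T' u j → freshBag (T ++ T') u (k +∞ j)
  fresh-++ (inj₁ (u∈T , refl)) _ = inj₁ (∈-++⁺ˡ u∈T , refl)
  fresh-++ {T} (inj₂ (_ , refl)) (inj₁ (u∈T' , refl)) = inj₁ (∈-++⁺ʳ T u∈T' , refl)
  fresh-++ {T} (inj₂ (u∉T , refl)) (inj₂ (u∉T' , refl)) =
    inj₂ ((λ u∈T++T' → [ u∉T , u∉T' ] (∈-++⁻ T u∈T++T')) , refl)

  -- Firing only ever releases transitions
  -- nested in N, so the transitions of a reachable state lie in DT(N); this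
  -- is what lets Flat(N), whose transitions are DT(N), mimic every run.

  step-DT : ∀ {N N₁ : DNet 𝕊} {t u} → Step N t N₁ → u ∈DT N₁ → u ∈DT N
  step-DT {dnet T _} (fire t∈T _) (top u∈T++T') with ∈-++⁻ T u∈T++T'
  ... | inj₁ u∈T  = top u∈T
  ... | inj₂ u∈T' = nested t∈T (top u∈T')
  step-DT {dnet T _} (fire t∈T _) (nested v∈T++T' u∈DTv) with ∈-++⁻ T v∈T++T'
  ... | inj₁ v∈T  = nested v∈T u∈DTv
  ... | inj₂ v∈T' = nested t∈T (nested v∈T' u∈DTv)

  reach-DT : ∀ {N N' : DNet 𝕊} {u} → N ⟶* N' → u ∈DT N' → u ∈DT N
  reach-DT ε                 u∈DT = u∈DT
  reach-DT ((_ , st) ◅ rest) u∈DT = step-DT st (reach-DT rest u∈DT)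

  reachable-transition : ∀ {N N' : DNet 𝕊} {u} → N ⟶* N' → u ∈ trans N' → u ∈DT N
  reachable-transition {N' = dnet _ _} r u∈T = reach-DT r (top u∈T)

  fireNet : DNet 𝕊 → DTrans 𝕊 → DNet 𝕊
  fireNet (dnet T b) (S ⇒ dnet T' b') = dnet (T ++ T') (fireBag b S b')

  -- Soundness transfers
  -- safety from N' to m; completeness transfers it from m back to N'.
  record Sound (m : Mark (𝕊 ⊎ DTrans 𝕊)) (N' : DNet 𝕊) : Set where
    field
      regular    : ∀ s k → m (inj₁ s) k → k ≡ bag N' s
      persistent : ∀ u k → m (inj₂ u) k → freshBag (trans N') u k

  record Complete (m : Mark (𝕊 ⊎ DTrans 𝕊)) (N' : DNet 𝕊) : Set where
    field
      regular    : ∀ s → m (inj₁ s) (bag N' s)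
      persistent : ∀ u k → freshBag (trans N') u k → ¬ ¬ m (inj₂ u) k

  fireBag-pre : ∀ {b S b'} {s : 𝕊} → S s ≡ true → fireBag b S b' s ≡ pred∞ (b s) +∞ b' s
  fireBag-pre S≡true rewrite S≡true = refl

  fireBag-skip : ∀ {b S b'} {s : 𝕊} → ¬ S s ≡ true → fireBag b S b' s ≡ b s +∞ b' s
  fireBag-skip {S = S} {s = s} s∉S with S s
  ... | true  = contradiction refl s∉S
  ... | false = refl

module Correspondence {𝕊 : Set} (pers : 𝕊 → Bool) (N : DNet 𝕊) where

  Place : Set
  Place = 𝕊 ⊎ DTrans 𝕊

  F : PNet Place
  F = Flat pers N

  open PNet F using (initial)

  initial-sound : Sound initial N
  initial-sound = record { regular = λ _ _ k≡ → k≡ ; persistent = λ _ _ fresh → fresh }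

  enabled⇒step : ∀ {m N₁ t} (t∈ : t ∈DT N) → Sound m N₁ → Enabled F m (t , t∈) →
                 Step N₁ t (fireNet N₁ t)
  enabled⇒step {m} {dnet T b} {S ⇒ dnet T' b'} t∈ snd enabled = fire t∈T preset-marked
    where
      open Sound snd
      t∈T : (S ⇒ dnet T' b') ∈ T
      t∈T = let k , mk , marked = enabled (inj₂ (S ⇒ dnet T' b')) refl
            in fresh-marked (persistent _ k mk) marked
      preset-marked : ∀ s → S s ≡ true → Marked (b s)
      preset-marked s s∈S = let k , mk , marked = enabled (inj₁ s) s∈S
                            in subst Marked (regular s k mk) marked

  sound-after : ∀ {m N₁ t} (t∈ : t ∈DT N) → Sound m N₁ →
                Sound (after F m (t , t∈)) (fireNet N₁ t)
  sound-after {m} {dnet T b} {S ⇒ dnet T' b'} t∈ snd =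
    record { regular = regular' ; persistent = persistent' }
    where
      open Sound snd
      regular' : ∀ s k' → after F m (_ , t∈) (inj₁ s) k' → k' ≡ fireBag b S b' s
      regular' s _ (k , _ , mk , refl , inj₁ (s∈S , refl)) =
        subst (λ x → pred∞ x +∞ b' s ≡ fireBag b S b' s) (sym (regular s k mk)) (sym (fireBag-pre {b = b} {S = S} {b' = b'} s∈S))
      regular' s _ (k , _ , mk , refl , inj₂ (s∉S , refl)) =
        subst (λ x → x +∞ b' s ≡ fireBag b S b' s) (sym (regular s k mk)) (sym (fireBag-skip {b = b} {S = S} {b' = b'} s∉S))
      persistent' : ∀ u k' → after F m (_ , t∈) (inj₂ u) k' → freshBag (T ++ T') u k'
      persistent' u _ (k , j , mk , fresh-j , inj₁ (_ , refl)) =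
        subst (λ x → freshBag (T ++ T') u (x +∞ j)) (sym (fresh-pred (persistent u k mk)))
              (fresh-++ (persistent u k mk) fresh-j)
      persistent' u _ (k , j , mk , fresh-j , inj₂ (_ , refl)) =
        fresh-++ (persistent u k mk) fresh-j

  represent : ∀ {m} → Reachable F m → ∃ λ N' → N ⟶* N' × Sound m N'
  represent init = N , ε , initial-sound
  represent (step r (t , t∈) enabled) =
    let N₁ , N⟶*N₁ , snd = represent r
    in fireNet N₁ t , N⟶*N₁ ◅◅ ((t , enabled⇒step t∈ snd enabled) ◅ ε) , sound-after t∈ snd

  Simulated : DNet 𝕊 → Set₁
  Simulated N' = Σ (Mark Place) λ m → Reachable F m × Complete m N'

  initial-simulated : Simulated N
  initial-simulated = initial , init , record { regular = λ _ → refl ; persistent = λ _ _ fresh → return fresh }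

  -- If t occurs in the state, p_t is marked, and the regular preset is marked
  -- as in the state, so the Flat transition is enabled.
  step⇒enabled : ∀ {m N₁ N₂ t} (t∈ : t ∈DT N) → Complete m N₁ → Step N₁ t N₂ →
                 m (inj₂ t) ∞ → Enabled F m (t , t∈)
  step⇒enabled t∈ cmp (fire _ preset-marked) mt (inj₁ s) s∈S =
    _ , Complete.regular cmp s , preset-marked s s∈S
  step⇒enabled t∈ cmp (fire _ _) mt (inj₂ _) refl = ∞ , mt , λ ()

  -- The persistent place p_u after firing t: its k tokens plus the j created
  -- by t (consuming one of ∞ tokens from p_t changes nothing).
  persistent-after : ∀ {m T k j u t} (t∈ : t ∈DT N) → freshBag T u k → m (inj₂ u) k →
                     freshBag (trans (postnet t)) u j → Dec (u ≡ t) →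
                     after F m (t , t∈) (inj₂ u) (k +∞ j)
  persistent-after {j = j} t∈ fresh-k mk fresh-j (yes u≡t) =
    _ , _ , mk , fresh-j , inj₁ (u≡t , cong (_+∞ j) (sym (fresh-pred fresh-k)))
  persistent-after t∈ fresh-k mk fresh-j (no u≢t) = _ , _ , mk , fresh-j , inj₂ (u≢t , refl)

  complete-after : ∀ {m N₁ t} (t∈ : t ∈DT N) → Complete m N₁ →
                   Complete (after F m (t , t∈)) (fireNet N₁ t)
  complete-after {m} {dnet T b} {S ⇒ dnet T' b'} t∈ cmp =
    record { regular = regular' ; persistent = persistent' }
    where
      open Complete cmp
      regular' : ∀ s → after F m (_ , t∈) (inj₁ s) (fireBag b S b' s)
      regular' s with S s
      ... | true  = b s , b' s , regular s , refl , inj₁ (refl , refl)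
      ... | false = b s , b' s , regular s , refl , inj₂ ((λ ()) , refl)
      persistent' : ∀ u k' → freshBag (T ++ T') u k' → ¬ ¬ after F m (_ , t∈) (inj₂ u) k'
      persistent' u k' fresh-k' = do
        k , fresh-k ← fresh-total T u
        j , fresh-j ← fresh-total T' u
        mk ← persistent u k fresh-k
        u≟t ← ¬¬-excluded-middle
        return (subst (after F m (_ , t∈) (inj₂ u)) (fresh-unique (fresh-++ fresh-k fresh-j) fresh-k')
                      (persistent-after {m = m} t∈ fresh-k mk fresh-j u≟t))

  simulate-step : ∀ {N₁ N₂} → N ⟶* N₁ → Simulated N₁ → N₁ ⟶ N₂ → ¬ ¬ Simulated N₂
  simulate-step N⟶*N₁ (m , rm , cmp) (t , st@(fire t∈T _)) = do
    mt ← Complete.persistent cmp t ∞ (inj₁ (t∈T , refl))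
    return (after F m (t , t∈) , step rm (t , t∈) (step⇒enabled t∈ cmp st mt) , complete-after t∈ cmp)
    where t∈ = reachable-transition N⟶*N₁ t∈T

  simulate : ∀ {N₁ N₂} → N ⟶* N₁ → Simulated N₁ → N₁ ⟶* N₂ → ¬ ¬ Simulated N₂
  simulate N⟶*N₁ sim ε = return sim
  simulate N⟶*N₁ sim (st ◅ rest) = do
    sim' ← simulate-step N⟶*N₁ sim st
    simulate (N⟶*N₁ ◅◅ st ◅ ε) sim' rest

  flat-safe⇒safe : OneInfSafe F → OneSafeD pers N
  flat-safe⇒safe flat-safe N' N⟶*N' s = safeVal-stable (pers s) (bag N' s) do
    m , rm , cmp ← simulate ε initial-simulated N⟶*N'
    return (flat-safe m rm (inj₁ s) (bag N' s) (Complete.regular cmp s))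

  safe⇒flat-safe : OneSafeD pers N → OneInfSafe F
  safe⇒flat-safe safe m rm q k mk with represent rm
  safe⇒flat-safe safe m rm (inj₁ s) k mk | N' , N⟶*N' , snd =
    subst (SafeVal (pers s)) (sym (Sound.regular snd s k mk)) (safe N' N⟶*N' s)
  safe⇒flat-safe safe m rm (inj₂ u) k mk | N' , N⟶*N' , snd =
    fresh-safe (Sound.persistent snd u k mk)

corollary2p5 : {𝕊 : Set} (pers : 𝕊 → Bool) (N : DNet 𝕊) →
    OneInfSafe (Flat pers N) ⇔ OneSafeD pers N
corollary2p5 pers N = mk⇔ flat-safe⇒safe safe⇒flat-safe
  where open Correspondence pers N
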